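{- Let $N$ be a 0,1-network with reactions $y_1\to y_1',\dots,y_m\to y_m'$. If either vertex $u_i$ or $v_i$ of $\mathcal H_N$ is almost balanced, then $x^{y_i}\in\mathcal I(N)$.
   Context: A chemical reaction network $N=(\mathscr S,\mathscr C,\mathscr R)$ consists of a finite set of species $\mathscr S$, complexes $\mathscr C\subseteq\mathbb Z_{\ge0}^{\mathscr S}$, and reactions $y\to y'$ with $y\ne y'$; every complex occurs in some reaction, every species lies in some complex's support, and there are no reactions $\varnothing\to y$. Reactions are indexed $1,\dots,m$, the $i$-th written $y_i\to y_i'$ with rate constant $\kappa_i$. $N$ is a 0,1-network if every complex lies in $\{0,1\}^{\mathscr S}$. $x^y=\prod_s x_s^{y_s}$; $\dot x_s=\sum_i\kappa_i x^{y_i}(y'_{i,s}-y_{i,s})\in\mathbb K(\kappa)[x]$ ($\kappa_i$ indeterminates, $\mathbb K$ a field of characteristic zero); the steady-state ideal is $\mathcal I(N)=\langle\dot x_s:s\in\mathscr S\rangle$. The network hypergraph $\mathcal H_N$ has $2m$ vertices $u_1,v_1,\dots,u_m,v_m$ ($u_i$ represents the reactant $y_i$ of reaction $i$, $v_i$ its product $y_i'$). Hyperedges: for each species $s$, $E_s=\{u_i: s\in\mathrm{supp}(y_i)\}\cup\{v_i: s\in\mathrm{supp}(y_i')\}$; for each reaction $i$, $E_i=\{u_i,v_i\}$ if $y_i'\ne\varnothing$ and $E_i=\varnothing$ otherwise. A vertex $w$ is almost balanced if there is a multiset $\mathscr E$ of edges (nonnegative multiplicities) and a splitting $\mathscr E=\mathscr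 E_r\sqcup\mathscr E_b$ into two submultisets whose multiplicities add up, such that, writing $\deg_{\mathscr E_c}(z)$ for the number of edges of $\mathscr E_c$ (with multiplicity) containing $z$, $\deg_{\mathscr E_r}(w)=\deg_{\mathscr E_b}(w)+k$ for some positive integer $k$ and $\deg_{\mathscr E_r}(z)=\deg_{\mathscr E_b}(z)$ for every other vertex $z$. -}

module Defs where

open import Level using (Level; _⊔_) renaming (suc to lsuc)
open import Data.Nat using (ℕ; zero; suc; _≥_) renaming (_+_ to _+ℕ_; _*_ to _*ℕ_)
open import Data.Fin using (Fin; zero; suc)
open import Data.Bool using (Bool; true; false; if_then_else_)
open import Data.Sum using (_⊎_; inj₁; inj₂)
open import Data.Product using (Σ; _×_; _,_; ∃; ∃-syntax)
open import Relation.Nullary using (¬_)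
open import Relation.Binary.PropositionalEquality using (_≡_)
open import Algebra.Bundles using (CommutativeRing)

natToR : ∀ {c ℓ} (R : CommutativeRing c ℓ) → ℕ → CommutativeRing.Carrier R
natToR R zero    = CommutativeRing.0# R
natToR R (suc n) = CommutativeRing._+_ R (CommutativeRing.1# R) (natToR R n)

record Field (c ℓ : Level) : Set (lsuc (c ⊔ ℓ)) where
  field
    commutativeRing : CommutativeRing c ℓ
  open CommutativeRing commutativeRing
  field
    1≉0       : ¬ (1# ≈ 0#)
    inverse   : ∀ a → ¬ (a ≈ 0#) → Σ Carrier (λ b → (a * b) ≈ 1#)
    charZero  : ∀ n → ¬ (natToR commutativeRing (suc n) ≈ 0#)
  open CommutativeRing commutativeRing public

-- The polynomial ring K[V] : the free commutative K-algebra on the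
-- variables V, presented by formal expressions modulo the congruence
-- generated by the commutative-ring axioms and the operations of K.

module Poly {c ℓ : Level} (K : Field c ℓ) where
  open Field K using (Carrier; 0#; 1#) renaming (_≈_ to _≈K_; _+_ to _+K_; _*_ to _*K_; -_ to -K_)

  data Pol (V : Set) : Set c where
    con  : Carrier → Pol V
    var  : V → Pol V
    _⊕_  : Pol V → Pol V → Pol V
    _⊗_  : Pol V → Pol V → Pol V
    ⊖_   : Pol V → Pol V

  infixl 6 _⊕_
  infixl 7 _⊗_
  infix  4 _≋_

  𝟘 𝟙 : ∀ {V} → Pol V
  𝟘 = con 0#
  𝟙 = con 1#

  data _≋_ {V : Set} : Pol V → Pol V → Set (c ⊔ ℓ) where
    ≋-refl  : ∀ {p} → p ≋ p
    ≋-sym   : ∀ {p q} → p ≋ q → q ≋ p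
    ≋-trans : ∀ {p q r} → p ≋ q → q ≋ r → p ≋ r
    ⊕-cong  : ∀ {p p' q q'} → p ≋ p' → q ≋ q' → p ⊕ q ≋ p' ⊕ q'
    ⊗-cong  : ∀ {p p' q q'} → p ≋ p' → q ≋ q' → p ⊗ q ≋ p' ⊗ q'
    ⊖-cong  : ∀ {p q} → p ≋ q → ⊖ p ≋ ⊖ q
    ⊕-assoc : ∀ p q r → (p ⊕ q) ⊕ r ≋ p ⊕ (q ⊕ r)
    ⊕-comm  : ∀ p q → p ⊕ q ≋ q ⊕ p
    ⊕-idˡ   : ∀ p → 𝟘 ⊕ p ≋ p
    ⊖-invˡ  : ∀ p → (⊖ p) ⊕ p ≋ 𝟘
    ⊗-assoc : ∀ p q r → (p ⊗ q) ⊗ r ≋ p ⊗ (q ⊗ r)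
    ⊗-comm  : ∀ p q → p ⊗ q ≋ q ⊗ p
    ⊗-idˡ   : ∀ p → 𝟙 ⊗ p ≋ p
    ⊗-distribˡ : ∀ p q r → p ⊗ (q ⊕ r) ≋ (p ⊗ q) ⊕ (p ⊗ r)
    con-cong : ∀ {a b} → a ≈K b → con a ≋ con b
    con-+   : ∀ a b → con a ⊕ con b ≋ con (a +K b)
    con-*   : ∀ a b → con a ⊗ con b ≋ con (a *K b)
    con-neg : ∀ a → ⊖ con a ≋ con (-K a)

  rename : ∀ {V W} → (V → W) → Pol V → Pol W
  rename f (con a) = con a
  rename f (var v) = var (f v)
  rename f (p ⊕ q) = rename f p ⊕ rename f q
  rename f (p ⊗ q) = rename f p ⊗ rename f q
  rename f (⊖ p)   = ⊖ rename f p

  ∑ : ∀ {V} n → (Fin n → Pol V) → Pol V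
  ∑ zero    f = 𝟘
  ∑ (suc n) f = f zero ⊕ ∑ n (λ i → f (suc i))

  ∏ : ∀ {V} n → (Fin n → Pol V) → Pol V
  ∏ zero    f = 𝟙
  ∏ (suc n) f = f zero ⊗ ∏ n (λ i → f (suc i))

-- 0,1-networks: species Fin n, reactions Fin m; reaction i is
-- y i → y' i, complexes being 0,1-vectors (Fin n → Bool).

record Network01 (n m : ℕ) : Set where
  field
    y y' : Fin m → Fin n → Bool
    nontrivial : ∀ i → ¬ (∀ s → y i s ≡ y' i s)
    reactantNonempty : ∀ i → ∃[ s ] (y i s ≡ true)
    speciesUsed : ∀ s → ∃[ i ] (y i s ≡ true ⊎ y' i s ≡ true)
    distinct : ∀ i j → (∀ s → y i s ≡ y j s) → (∀ s → y' i s ≡ y' j s) → i ≡ j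

module _ {n m : ℕ} (N : Network01 n m) where
  open Network01 N

  -- vertices u_i (reactant of reaction i) and v_i (product of reaction i)
  data Vertex : Set where
    u v : Fin m → Vertex

  -- hyperedges: E_s for species s (inj₁ s), E_i for reaction i (inj₂ i)
  Edge : Set
  Edge = Fin n ⊎ Fin m

  nonemptyB : (Fin n → Bool) → Bool
  nonemptyB c = anyFin n c
    where
    anyFin : ∀ k → (Fin k → Bool) → Bool
    anyFin zero    f = false
    anyFin (suc k) f = if f zero then true else anyFin k (λ j → f (suc j))

  eqFin : ∀ {k} → Fin k → Fin k → Bool
  eqFin zero    zero    = true
  eqFin zero    (suc _) = false
  eqFin (suc _) zero    = false
  eqFin (suc a) (suc b) = eqFin a b

  inEdge : Edge → Vertex → Bool
  inEdge (inj₁ s) (u i) = y i s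
  inEdge (inj₁ s) (v i) = y' i s
  inEdge (inj₂ j) (u i) = if nonemptyB (y' j) then eqFin j i else false
  inEdge (inj₂ j) (v i) = if nonemptyB (y' j) then eqFin j i else false

  sumFin : ∀ k → (Fin k → ℕ) → ℕ
  sumFin zero    f = 0
  sumFin (suc k) f = f zero +ℕ sumFin k (λ j → f (suc j))

  b2n : Bool → ℕ
  b2n true  = 1
  b2n false = 0

  deg : (Edge → ℕ) → Vertex → ℕ
  deg μ z = sumFin n (λ s → μ (inj₁ s) *ℕ b2n (inEdge (inj₁ s) z))
          +ℕ sumFin m (λ i → μ (inj₂ i) *ℕ b2n (inEdge (inj₂ i) z))

  -- w is almost balanced: a multiset of edges split into red (μr) and
  -- blue (μb) parts with deg_r w = deg_b w + k (k ≥ 1), and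
  -- deg_r z = deg_b z for every other vertex z
  AlmostBalanced : Vertex → Set
  AlmostBalanced w =
    Σ (Edge → ℕ) λ μr → Σ (Edge → ℕ) λ μb → Σ ℕ λ k →
      k ≥ 1 × deg μr w ≡ deg μb w +ℕ k ×
      (∀ z → ¬ (z ≡ w) → deg μr z ≡ deg μb z)

  -- Steady-state ideal.  Variables: κ_i (inj₁ i) and x_s (inj₂ s);
  -- polynomials in K[κ, x].

  module _ {c ℓ : Level} (K : Field c ℓ) where
    open Poly K

    Var : Set
    Var = Fin m ⊎ Fin n

    b2p : Bool → Pol Var
    b2p true  = 𝟙
    b2p false = 𝟘

    monomial : (Fin n → Bool) → Pol Var
    monomial c = ∏ n (λ s → if c s then var (inj₂ s) else 𝟙)

    xdot : Fin n → Pol Var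
    xdot s = ∑ m (λ i → (var (inj₁ i) ⊗ monomial (y i))
                         ⊗ (b2p (y' i s) ⊕ ⊖ b2p (y i s)))

    -- f ∈ 𝓘(N) ⊆ 𝕂(κ)[x], for f ∈ 𝕂[κ][x], expressed by clearing
    -- denominators: some nonzero d ∈ 𝕂[κ] and c_s ∈ 𝕂[κ][x] with
    -- d · f = Σ_s c_s ẋ_s.
    InSteadyStateIdeal : Pol Var → Set (c ⊔ ℓ)
    InSteadyStateIdeal f =
      Σ (Pol (Fin m)) λ d → ¬ (d ≋ 𝟘) ×
      Σ (Fin n → Pol Var) λ cs →
        rename inj₁ d ⊗ f ≋ ∑ n (λ s → cs s ⊗ xdot s)

-- Take the species coefficients c_s = μr(E_s) − μb(E_s) of the red/blue edge multisets.
-- Exchanging the sums over species and reactions gives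
--   Σ_s c_s ẋ_s = Σ_j κ_j x^{y_j} (δ(v_j) − δ(u_j)),
-- where δ(z) is the part of deg_r z − deg_b z coming from the species edges.  A reaction
-- edge E_j contains u_j exactly when it contains v_j, so δ(v_j) − δ(u_j) is also the
-- difference of the full degree excesses at v_j and u_j.  These vanish away from the
-- almost balanced vertex w, where the excess is k ≥ 1, so the combination equals
-- ± k κ_i x^{y_i}; since char 𝕂 = 0, the factor k κ_i is a nonzero element of 𝕂[κ].
module Submission where

open import Defs
open import Level using (Level; _⊔_)
open import Data.Nat using (ℕ; zero; suc) renaming (_+_ to _+ℕ_; _*_ to _*ℕ_)
import Data.Nat.Properties as ℕₚ
open import Data.Nat.Tactic.RingSolver using (solve-∀)
open import Data.Fin using (Fin; zero; suc; _≟_)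
open import Data.Fin.Properties using (punchInᵢ≢i)
open import Data.Sum using (_⊎_; inj₁; inj₂; [_,_])
open import Data.Empty using (⊥-elim)
open import Data.Product using (Σ; _,_)
open import Data.Bool using (Bool; true; false)
open import Data.Vec.Functional using (Vector)
open import Function using (_∘_)
open import Relation.Nullary using (¬_; Dec; yes; no)
import Relation.Nullary.Decidable as Dec
open import Relation.Binary.PropositionalEquality as ≡ using (_≡_; _≢_; cong; cong₂)
open import Relation.Binary.Bundles using (Setoid)
open import Algebra.Bundles using (CommutativeMonoid; CommutativeRing)
import Algebra.Consequences.Setoid as Consequences
import Algebra.Properties.CommutativeMonoid.Sum as CommutativeMonoidSum
import Algebra.Properties.CommutativeSemigroup as CommutativeSemigroupProperties
import Algebra.Properties.Semiring.Sum as SemiringSum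
import Algebra.Properties.Semiring.Mult as SemiringMult
import Algebra.Properties.Ring as RingProperties
import Algebra.Solver.CommutativeMonoid as CommutativeMonoidSolver
import Relation.Binary.Reasoning.Setoid as SetoidReasoning

cross-cancel : ∀ {a b a′ b′ r r′ k k′} →
  a +ℕ r ≡ b +ℕ r′ +ℕ k → a′ +ℕ r ≡ b′ +ℕ r′ +ℕ k′ →
  a +ℕ b′ +ℕ k′ ≡ a′ +ℕ b +ℕ k
cross-cancel {a} {b} {a′} {b′} {r} {r′} {k} {k′} eq eq′ =
  ℕₚ.+-cancelʳ-≡ (r +ℕ r′) _ _ (begin
    a +ℕ b′ +ℕ k′ +ℕ (r +ℕ r′)         ≡⟨ regroup a b′ k′ r r′ ⟩
    (a +ℕ r) +ℕ (b′ +ℕ r′ +ℕ k′)       ≡⟨ cong₂ _+ℕ_ eq (≡.sym eq′) ⟩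
    (b +ℕ r′ +ℕ k) +ℕ (a′ +ℕ r)        ≡⟨ regroup′ a′ b k r r′ ⟨
    a′ +ℕ b +ℕ k +ℕ (r +ℕ r′)          ∎)
  where
  open ≡.≡-Reasoning
  regroup : ∀ a b′ k′ r r′ → a +ℕ b′ +ℕ k′ +ℕ (r +ℕ r′) ≡ (a +ℕ r) +ℕ (b′ +ℕ r′ +ℕ k′)
  regroup = solve-∀
  regroup′ : ∀ a′ b k r r′ → a′ +ℕ b +ℕ k +ℕ (r +ℕ r′) ≡ (b +ℕ r′ +ℕ k) +ℕ (a′ +ℕ r)
  regroup′ = solve-∀

module CommutativeMonoidProperties {a ℓ} (M : CommutativeMonoid a ℓ) where
  open CommutativeMonoid M
  open CommutativeMonoidSum M using (sum; sum-remove; sum-cong-≋; sum-replicate-zero)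

  sum-single : ∀ {k} (t : Vector Carrier k) i → (∀ j → j ≢ i → t j ≈ ε) → sum t ≈ t i
  sum-single {suc k} t i vanish = trans (sum-remove {i = i} t) (trans
    (∙-congˡ (trans (sum-cong-≋ (λ j → vanish _ (punchInᵢ≢i i j))) (sum-replicate-zero k)))
    (identityʳ (t i)))

module CommutativeRingProperties {c ℓ} (R : CommutativeRing c ℓ) where
  open CommutativeRing R
  open SemiringSum semiring using (sum; sum-cong-≋; ∑-distrib-+; *-distribˡ-sum)
  open SemiringMult semiring using (_×_; ×-homo-+)
  open RingProperties ring using (-1*x≈-x; -‿+-comm; ⁻¹-anti-homo‿-; x≈y⇒x∙y⁻¹≈ε; x∙y⁻¹≈ε⇒x≈y)
  open CommutativeMonoidSolver +-commutativeMonoid using (solve; _⊕_; _⊜_)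
  open SetoidReasoning setoid

  sum-neg : ∀ {k} (f : Vector Carrier k) → sum (λ i → - f i) ≈ - sum f
  sum-neg f = begin
    sum (λ i → - f i)          ≈⟨ sum-cong-≋ (λ i → sym (-1*x≈-x (f i))) ⟩
    sum (λ i → - 1# * f i)     ≈⟨ *-distribˡ-sum (- 1#) f ⟨
    - 1# * sum f               ≈⟨ -1*x≈-x (sum f) ⟩
    - sum f                    ∎

  sum-sub : ∀ {k} (f g : Vector Carrier k) → sum (λ i → f i - g i) ≈ sum f - sum g
  sum-sub f g = trans (∑-distrib-+ f (λ i → - g i)) (+-congˡ (sum-neg g))

  difference-of-differences : ∀ {a b a′ b′ k k′} → a + b′ + k′ ≈ a′ + b + k →
    (a - b) - (a′ - b′) ≈ k - k′
  difference-of-differences {a} {b} {a′} {b′} {k} {k′} eq = x∙y⁻¹≈ε⇒x≈y _ _ (begin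
    ((a - b) - (a′ - b′)) - (k - k′)
      ≈⟨ +-cong (+-congˡ (⁻¹-anti-homo‿- a′ b′)) (⁻¹-anti-homo‿- k k′) ⟩
    ((a - b) + (b′ - a′)) + (k′ - k)
      ≈⟨ solve 6 (λ a b b′ a′ k′ k → (((a ⊕ b) ⊕ (b′ ⊕ a′)) ⊕ (k′ ⊕ k))
                                     ⊜ (((a ⊕ b′) ⊕ k′) ⊕ (a′ ⊕ (b ⊕ k))))
           refl a (- b) b′ (- a′) k′ (- k) ⟩
    (a + b′ + k′) + (- a′ + (- b + - k))
      ≈⟨ +-congˡ (trans (+-congˡ (-‿+-comm b k)) (-‿+-comm a′ (b + k))) ⟩
    (a + b′ + k′) - (a′ + (b + k))
      ≈⟨ x≈y⇒x∙y⁻¹≈ε (trans eq (+-assoc a′ b k)) ⟩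
    0#  ∎)

  difference-of-differences-×1 : ∀ {a b a′ b′ k k′} → a +ℕ b′ +ℕ k′ ≡ a′ +ℕ b +ℕ k →
    (a × 1# - b × 1#) - (a′ × 1# - b′ × 1#) ≈ k × 1# - k′ × 1#
  difference-of-differences-×1 {a} {b} {a′} {b′} {k} {k′} eq = difference-of-differences (begin
    a × 1# + b′ × 1# + k′ × 1#      ≈⟨ expand a b′ k′ ⟨
    (a +ℕ b′ +ℕ k′) × 1#            ≡⟨ cong (_× 1#) eq ⟩
    (a′ +ℕ b +ℕ k) × 1#             ≈⟨ expand a′ b k ⟩
    a′ × 1# + b × 1# + k × 1#       ∎)
    where
    expand : ∀ a b d → (a +ℕ b +ℕ d) × 1# ≈ a × 1# + b × 1# + d × 1#
    expand a b d = trans (×-homo-+ 1# (a +ℕ b) d) (+-congʳ (×-homo-+ 1# a b))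

module Polynomials {c ℓ : Level} (K : Field c ℓ) where
  open Poly K
  private module K = Field K

  ≋-setoid : Set → Setoid c (c ⊔ ℓ)
  ≋-setoid V = record
    { Carrier = Pol V ; _≈_ = _≋_
    ; isEquivalence = record { refl = ≋-refl ; sym = ≋-sym ; trans = ≋-trans } }

  polyRing : Set → CommutativeRing c (c ⊔ ℓ)
  polyRing V = record
    { isCommutativeRing = record
      { isRing = record
        { +-isAbelianGroup = record
          { isGroup = record
            { isMonoid = record
              { isSemigroup = record
                { isMagma = record { isEquivalence = Setoid.isEquivalence (≋-setoid V) ; ∙-cong = ⊕-cong }
                ; assoc = ⊕-assoc }
              ; identity = comm∧idˡ⇒id ⊕-comm ⊕-idˡ }
            ; inverse = comm∧invˡ⇒inv ⊕-comm ⊖-invˡ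
            ; ⁻¹-cong = ⊖-cong }
          ; comm = ⊕-comm }
        ; *-cong = ⊗-cong
        ; *-assoc = ⊗-assoc
        ; *-identity = comm∧idˡ⇒id ⊗-comm ⊗-idˡ
        ; distrib = comm∧distrˡ⇒distr ⊕-cong ⊗-comm ⊗-distribˡ }
      ; *-comm = ⊗-comm } }
    where open Consequences (≋-setoid V)

  module _ {V : Set} where
    open SemiringSum (CommutativeRing.semiring (polyRing V)) using (sum)
    open SemiringMult (CommutativeRing.semiring (polyRing V)) using (_×_)

    ∑≡sum : ∀ k (f : Fin k → Pol V) → ∑ k f ≡ sum f
    ∑≡sum zero    f = ≡.refl
    ∑≡sum (suc k) f = cong (f zero ⊕_) (∑≡sum k (f ∘ suc))

    con-natToR : ∀ k → con (natToR K.commutativeRing k) ≋ k × 𝟙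
    con-natToR zero    = ≋-refl
    con-natToR (suc k) = ≋-trans (≋-sym (con-+ K.1# _)) (⊕-cong ≋-refl (con-natToR k))

    evaluate : (V → K.Carrier) → Pol V → K.Carrier
    evaluate ρ (con a) = a
    evaluate ρ (var x) = ρ x
    evaluate ρ (p ⊕ q) = evaluate ρ p K.+ evaluate ρ q
    evaluate ρ (p ⊗ q) = evaluate ρ p K.* evaluate ρ q
    evaluate ρ (⊖ p)   = K.- evaluate ρ p

    evaluate-cong : ∀ ρ {p q} → p ≋ q → evaluate ρ p K.≈ evaluate ρ q
    evaluate-cong ρ ≋-refl               = K.refl
    evaluate-cong ρ (≋-sym p≋q)          = K.sym (evaluate-cong ρ p≋q)
    evaluate-cong ρ (≋-trans p≋q q≋r)    = K.trans (evaluate-cong ρ p≋q) (evaluate-cong ρ q≋r)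
    evaluate-cong ρ (⊕-cong p≋p′ q≋q′)   = K.+-cong (evaluate-cong ρ p≋p′) (evaluate-cong ρ q≋q′)
    evaluate-cong ρ (⊗-cong p≋p′ q≋q′)   = K.*-cong (evaluate-cong ρ p≋p′) (evaluate-cong ρ q≋q′)
    evaluate-cong ρ (⊖-cong p≋q)         = K.-‿cong (evaluate-cong ρ p≋q)
    evaluate-cong ρ (⊕-assoc _ _ _)      = K.+-assoc _ _ _
    evaluate-cong ρ (⊕-comm _ _)         = K.+-comm _ _
    evaluate-cong ρ (⊕-idˡ _)            = K.+-identityˡ _
    evaluate-cong ρ (⊖-invˡ _)           = K.-‿inverseˡ _
    evaluate-cong ρ (⊗-assoc _ _ _)      = K.*-assoc _ _ _
    evaluate-cong ρ (⊗-comm _ _)         = K.*-comm _ _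
    evaluate-cong ρ (⊗-idˡ _)            = K.*-identityˡ _
    evaluate-cong ρ (⊗-distribˡ _ _ _)   = K.distribˡ _ _ _
    evaluate-cong ρ (con-cong a≈b)       = a≈b
    evaluate-cong ρ (con-+ _ _)          = K.refl
    evaluate-cong ρ (con-* _ _)          = K.refl
    evaluate-cong ρ (con-neg _)          = K.refl

    multiple-of-var-nonzero : ∀ k (x : V) → ¬ (con (natToR K.commutativeRing (suc k)) ⊗ var x ≋ 𝟘)
    multiple-of-var-nonzero k x k·x≋0 =
      K.charZero k (K.trans (K.sym (K.*-identityʳ _)) (evaluate-cong (λ _ → K.1#) k·x≋0))

module Network {c ℓ : Level} (K : Field c ℓ) {n m : ℕ} (N : Network01 n m) where
  open Network01 N
  open Poly K using (Pol; con; var; ∑; _⊗_)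
  open Polynomials K
  open CommutativeRing (polyRing (Var N K)) hiding (zero)
  open SemiringSum semiring using (sum; sum-cong-≋; sum-cong-≗; ∑-comm; *-distribˡ-sum)
  open SemiringMult semiring using (_×_; ×-homo-+; ×1-homo-*)
  open RingProperties ring
    using (-‿distribˡ-*; -‿distribʳ-*; x[y-z]≈xy-xz; [y-z]x≈yx-zx; -0#≈0#; -‿involutive)
  open CommutativeSemigroupProperties *-commutativeSemigroup using (x∙yz≈y∙xz)
  open CommutativeMonoidProperties +-commutativeMonoid using (sum-single)
  open CommutativeRingProperties (polyRing (Var N K))
  open SetoidReasoning setoid

  P : Set c
  P = Pol (Var N K)

  flux : Fin m → P
  flux j = var (inj₁ j) * monomial N K (y j)

  combination : (Fin n → P) → P
  combination cs = sum (λ s → cs s * xdot N K s)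

  ⟨_,_⟩ : (Fin n → P) → (Fin n → Bool) → P
  ⟨ w , c ⟩ = sum (λ s → w s * b2p N K (c s))

  combination-neg : ∀ cs → combination (λ s → - cs s) ≈ - combination cs
  combination-neg cs =
    trans (sum-cong-≋ (λ s → sym (-‿distribˡ-* (cs s) _))) (sum-neg (λ s → cs s * xdot N K s))

  combination-exchange : ∀ w →
    combination w ≈ sum (λ j → flux j * (⟨ w , y' j ⟩ - ⟨ w , y j ⟩))
  combination-exchange w = begin
    sum (λ s → w s * xdot N K s)
      ≡⟨ sum-cong-≗ (λ s → cong (w s *_) (∑≡sum m _)) ⟩
    sum (λ s → w s * sum (λ j → flux j * δ j s))
      ≈⟨ sum-cong-≋ (λ s → *-distribˡ-sum (w s) (λ j → flux j * δ j s)) ⟩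
    sum (λ s → sum (λ j → w s * (flux j * δ j s)))
      ≈⟨ sum-cong-≋ (λ s → sum-cong-≋ (λ j → x∙yz≈y∙xz (w s) (flux j) (δ j s))) ⟩
    sum (λ s → sum (λ j → flux j * (w s * δ j s)))
      ≈⟨ ∑-comm (λ s j → flux j * (w s * δ j s)) ⟩
    sum (λ j → sum (λ s → flux j * (w s * δ j s)))
      ≈⟨ sum-cong-≋ (λ j → *-distribˡ-sum (flux j) (λ s → w s * δ j s)) ⟨
    sum (λ j → flux j * sum (λ s → w s * δ j s))
      ≈⟨ sum-cong-≋ (λ j → *-congˡ (pairing-sub j)) ⟩
    sum (λ j → flux j * (⟨ w , y' j ⟩ - ⟨ w , y j ⟩))  ∎
    where
    δ : Fin m → Fin n → P
    δ j s = b2p N K (y' j s) - b2p N K (y j s)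
    pairing-sub : ∀ j → sum (λ s → w s * δ j s) ≈ ⟨ w , y' j ⟩ - ⟨ w , y j ⟩
    pairing-sub j = trans (sum-cong-≋ (λ s → x[y-z]≈xy-xz (w s) (b2p N K (y' j s)) (b2p N K (y j s))))
                          (sum-sub (λ s → w s * b2p N K (y' j s)) (λ s → w s * b2p N K (y j s)))

  b2p≈b2n×1 : ∀ b → b2p N K b ≈ b2n N b × 1#
  b2p≈b2n×1 true  = sym (+-identityʳ 1#)
  b2p≈b2n×1 false = refl

  sumFin-×1 : ∀ k (f : Fin k → ℕ) → sumFin N k f × 1# ≈ sum (λ i → f i × 1#)
  sumFin-×1 zero    f = refl
  sumFin-×1 (suc k) f = trans (×-homo-+ 1# (f zero) _) (+-congˡ (sumFin-×1 k (f ∘ suc)))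

  pairing-×1 : ∀ (μ : Fin n → ℕ) c →
    ⟨ (λ s → μ s × 1#) , c ⟩ ≈ sumFin N n (λ s → μ s *ℕ b2n N (c s)) × 1#
  pairing-×1 μ c = begin
    sum (λ s → μ s × 1# * b2p N K (c s))          ≈⟨ sum-cong-≋ (λ s → *-congˡ (b2p≈b2n×1 (c s))) ⟩
    sum (λ s → μ s × 1# * b2n N (c s) × 1#)       ≈⟨ sum-cong-≋ (λ s → ×1-homo-* (μ s) _) ⟨
    sum (λ s → (μ s *ℕ b2n N (c s)) × 1#)        ≈⟨ sumFin-×1 n _ ⟨
    sumFin N n (λ s → μ s *ℕ b2n N (c s)) × 1#  ∎

  -- deg μ z ≡ speciesDegree μ z + reactionDegree μ z holds definitionally.
  speciesDegree reactionDegree : (Edge N → ℕ) → Vertex N → ℕ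
  speciesDegree  μ z = sumFin N n (λ s → μ (inj₁ s) *ℕ b2n N (inEdge N (inj₁ s) z))
  reactionDegree μ z = sumFin N m (λ j → μ (inj₂ j) *ℕ b2n N (inEdge N (inj₂ j) z))

  weight : (μr μb : Edge N → ℕ) → Fin n → P
  weight μr μb s = μr (inj₁ s) × 1# - μb (inj₁ s) × 1#

  pairing-weight : ∀ μr μb z →
    ⟨ weight μr μb , (λ s → inEdge N (inj₁ s) z) ⟩ ≈ speciesDegree μr z × 1# - speciesDegree μb z × 1#
  pairing-weight μr μb z = begin
    sum (λ s → (μ̂r s - μ̂b s) * b2p N K (edge s))
      ≈⟨ sum-cong-≋ (λ s → [y-z]x≈yx-zx (b2p N K (edge s)) (μ̂r s) (μ̂b s)) ⟩
    sum (λ s → μ̂r s * b2p N K (edge s) - μ̂b s * b2p N K (edge s))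
      ≈⟨ sum-sub (λ s → μ̂r s * b2p N K (edge s)) (λ s → μ̂b s * b2p N K (edge s)) ⟩
    ⟨ μ̂r , edge ⟩ - ⟨ μ̂b , edge ⟩
      ≈⟨ +-cong (pairing-×1 (μr ∘ inj₁) edge) (-‿cong (pairing-×1 (μb ∘ inj₁) edge)) ⟩
    speciesDegree μr z × 1# - speciesDegree μb z × 1#  ∎
    where
    edge : Fin n → Bool
    edge s = inEdge N (inj₁ s) z
    μ̂r μ̂b : Fin n → P
    μ̂r s = μr (inj₁ s) × 1#
    μ̂b s = μb (inj₁ s) × 1#

  netExcess : (Vertex N → ℕ) → Fin m → P
  netExcess e j = e (v j) × 1# - e (u j) × 1#

  -- The reaction edge E_j meets u_j and v_j alike, so its multiplicities cancel.
  speciesExcess-difference : ∀ μr μb (e : Vertex N → ℕ) →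
    (∀ z → deg N μr z ≡ deg N μb z +ℕ e z) → ∀ j →
    speciesDegree μr (v j) +ℕ speciesDegree μb (u j) +ℕ e (u j)
      ≡ speciesDegree μr (u j) +ℕ speciesDegree μb (v j) +ℕ e (v j)
  speciesExcess-difference μr μb e balanced j =
    cross-cancel {speciesDegree μr (v j)} {speciesDegree μb (v j)}
                 {speciesDegree μr (u j)} {speciesDegree μb (u j)}
                 {reactionDegree μr (u j)} {reactionDegree μb (u j)} {e (v j)} {e (u j)}
                 (balanced (v j)) (balanced (u j))

  balance-identity : ∀ μr μb (e : Vertex N → ℕ) →
    (∀ z → deg N μr z ≡ deg N μb z +ℕ e z) →
    combination (weight μr μb) ≈ sum (λ j → flux j * netExcess e j)
  balance-identity μr μb e balanced =
    trans (combination-exchange (weight μr μb)) (sum-cong-≋ (λ j → *-congˡ (net j)))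
    where
    net : ∀ j → ⟨ weight μr μb , y' j ⟩ - ⟨ weight μr μb , y j ⟩ ≈ netExcess e j
    net j = trans (+-cong (pairing-weight μr μb (v j)) (-‿cong (pairing-weight μr μb (u j))))
                  (difference-of-differences-×1
                    {speciesDegree μr (v j)} {speciesDegree μb (v j)}
                    {speciesDegree μr (u j)} {speciesDegree μb (u j)} {e (v j)} {e (u j)}
                    (speciesExcess-difference μr μb e balanced j))

  u-injective : ∀ {i j} → u {N = N} i ≡ u j → i ≡ j
  u-injective ≡.refl = ≡.refl

  v-injective : ∀ {i j} → v {N = N} i ≡ v j → i ≡ j
  v-injective ≡.refl = ≡.refl

  _≟ᵥ_ : (z w : Vertex N) → Dec (z ≡ w)
  u i ≟ᵥ u j = Dec.map′ (cong u) u-injective (i ≟ j)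
  u i ≟ᵥ v j = no λ ()
  v i ≟ᵥ u j = no λ ()
  v i ≟ᵥ v j = Dec.map′ (cong v) v-injective (i ≟ j)

  excessAt : Vertex N → ℕ → Vertex N → ℕ
  excessAt w k z with z ≟ᵥ w
  ... | yes _ = k
  ... | no  _ = 0

  excessAt-self : ∀ w k → excessAt w k w ≡ k
  excessAt-self w k with w ≟ᵥ w
  ... | yes _   = ≡.refl
  ... | no  w≢w = ⊥-elim (w≢w ≡.refl)

  excessAt-other : ∀ {w k z} → z ≢ w → excessAt w k z ≡ 0
  excessAt-other {w} {k} {z} z≢w with z ≟ᵥ w
  ... | yes z≡w = ⊥-elim (z≢w z≡w)
  ... | no  _   = ≡.refl

  almostBalanced⇒excess : ∀ {w} → AlmostBalanced N w →
    Σ (Edge N → ℕ) λ μr → Σ (Edge N → ℕ) λ μb → Σ ℕ λ k →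
      ∀ z → deg N μr z ≡ deg N μb z +ℕ excessAt w (suc k) z
  almostBalanced⇒excess (_ , _ , zero , () , _)
  almostBalanced⇒excess {w} (μr , μb , suc k , _ , excess-w , balanced-elsewhere) =
    μr , μb , k , balanced
    where
    balanced : ∀ z → deg N μr z ≡ deg N μb z +ℕ excessAt w (suc k) z
    balanced z with z ≟ᵥ w
    ... | yes ≡.refl = excess-w
    ... | no  z≢w    = ≡.trans (balanced-elsewhere z z≢w) (≡.sym (ℕₚ.+-identityʳ _))

  excess-vanishes : ∀ {e : Vertex N → ℕ} {j} → e (u j) ≡ 0 → e (v j) ≡ 0 →
    flux j * netExcess e j ≈ 0#
  excess-vanishes eu ev rewrite eu | ev = trans (*-congˡ (-‿inverseʳ 0#)) (zeroʳ _)

  netFlux-excessAt-product : ∀ i k →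
    sum (λ j → flux j * netExcess (excessAt (v i) k) j) ≈ flux i * k × 1#
  netFlux-excessAt-product i k =
    trans (sum-single _ i (λ j j≢i →
             excess-vanishes {excessAt (v i) k} ≡.refl (excessAt-other (j≢i ∘ v-injective))))
          (*-congˡ at-i)
    where
    at-i : netExcess (excessAt (v i) k) i ≈ k × 1#
    at-i rewrite excessAt-self (v i) k =
      trans (+-congˡ -0#≈0#) (+-identityʳ _)

  netFlux-excessAt-reactant : ∀ i k →
    sum (λ j → flux j * netExcess (excessAt (u i) k) j) ≈ - (flux i * k × 1#)
  netFlux-excessAt-reactant i k =
    trans (sum-single _ i (λ j j≢i →
             excess-vanishes {excessAt (u i) k} (excessAt-other (j≢i ∘ u-injective)) ≡.refl))
          (trans (*-congˡ at-i) (sym (-‿distribʳ-* (flux i) _)))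
    where
    at-i : netExcess (excessAt (u i) k) i ≈ - (k × 1#)
    at-i rewrite excessAt-self (u i) k =
      +-identityˡ _

  CombinesToMultipleOfFlux : Fin m → Set (c ⊔ ℓ)
  CombinesToMultipleOfFlux i =
    Σ (Fin n → P) λ cs → Σ ℕ λ k → combination cs ≈ flux i * suc k × 1#

  product-combination : ∀ i → AlmostBalanced N (v i) → CombinesToMultipleOfFlux i
  product-combination i almostBalanced with almostBalanced⇒excess almostBalanced
  ... | μr , μb , k , balanced = weight μr μb , k ,
    trans (balance-identity μr μb _ balanced) (netFlux-excessAt-product i (suc k))

  reactant-combination : ∀ i → AlmostBalanced N (u i) → CombinesToMultipleOfFlux i
  reactant-combination i almostBalanced with almostBalanced⇒excess almostBalanced
  ... | μr , μb , k , balanced = (λ s → - weight μr μb s) , k , (begin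
    combination (λ s → - weight μr μb s)                          ≈⟨ combination-neg _ ⟩
    - combination (weight μr μb)                                  ≈⟨ -‿cong (balance-identity μr μb _ balanced) ⟩
    - sum (λ j → flux j * netExcess (excessAt (u i) (suc k)) j)   ≈⟨ -‿cong (netFlux-excessAt-reactant i (suc k)) ⟩
    - - (flux i * suc k × 1#)                                     ≈⟨ -‿involutive _ ⟩
    flux i * suc k × 1#                                           ∎)

  combination⇒inSteadyStateIdeal : ∀ i → CombinesToMultipleOfFlux i →
    InSteadyStateIdeal N K (monomial N K (y i))
  combination⇒inSteadyStateIdeal i (cs , k , cs≈k·flux) =
    con k̂ ⊗ var i , multiple-of-var-nonzero k i , cs , (begin
      (con k̂ * var (inj₁ i)) * monomial N K (y i)   ≈⟨ *-assoc _ _ _ ⟩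
      con k̂ * flux i                               ≈⟨ *-comm _ _ ⟩
      flux i * con k̂                               ≈⟨ *-congˡ (con-natToR (suc k)) ⟩
      flux i * suc k × 1#                          ≈⟨ cs≈k·flux ⟨
      combination cs                               ≡⟨ ∑≡sum n _ ⟨
      ∑ n (λ s → cs s * xdot N K s)                ∎)
    where
    k̂ = natToR (Field.commutativeRing K) (suc k)

corollary3p7 : {c ℓ : Level} (K : Field c ℓ) {n m : ℕ} (N : Network01 n m) (i : Fin m) →
    AlmostBalanced N (u i) ⊎ AlmostBalanced N (v i) →
    InSteadyStateIdeal N K (monomial N K (Network01.y N i))
corollary3p7 K N i almostBalanced =
  combination⇒inSteadyStateIdeal i
    ([ reactant-combination i , product-combination i ] almostBalanced)
  where open Network K N
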